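{- Let $R$ be injective and univalent. Then $R$ is a non-empty cycle (i.e. a cycle with $R\neq\mathsf{O}$) if and only if there exists a point $p$ such that $p\mathbin{;}R\subseteq R^+$ and $p\subseteq R^{\top}\mathbin{;}\mathsf{L}$.
   Context: $(B,\cup,\mathbin{;},\overline{\,\cdot\,},{}^{\top},{}^{*},\mathsf{I})$ is a Kleene relation algebra; all variables range over $B$. That is, $(B,\cup,\mathbin{;},\overline{\,\cdot\,},{}^{\top},\mathsf{I})$ is a relation algebra: $\cup$ is associative and commutative and $R=\overline{\overline{R}\cup\overline{S}}\cup\overline{\overline{R}\cup S}$; $\mathbin{;}$ is associative, $(R\cup S)\mathbin{;}T=R\mathbin{;}T\cup S\mathbin{;}T$, $R\mathbin{;}\mathsf{I}=R$; $(R^{\top})^{\top}=R$, $(R\cup S)^{\top}=R^{\top}\cup S^{\top}$, $(R\mathbin{;}S)^{\top}=S^{\top}\mathbin{;}R^{\top}$; $R^{\top}\mathbin{;}\overline{R\mathbin{;}S}\cup\overline{S}=\overline{S}$. The order is $R\subseteq S$ iff $R\cup S=S$; $R\cap S=\overline{\overline{R}\cup\overline{S}}$; $\mathsf{L}=R\cup\overline{R}$ is the greatest and $\mathsf{O}=R\cap\overline{R}$ the least element. The star satisfies $\mathsf{I}\cup R\mathbin{;}R^*\subseteq R^*$, $\mathsf{I}\cup R^*\mathbin{;}R\subseteq R^*$, $S\cup R\mathbin{;}Q\subseteq Q\Rightarrow R^*\mathbin{;}S\subseteq Q$, $S\cup Q\mathbin{;}R\subseteq Q\Rightarrow S\mathbin{;}R^*\subseteq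 Q$. Write $R^+=R\mathbin{;}R^*$ and $R^{\top*}=(R^{\top})^*$. The algebra satisfies the Tarski rule ($R\neq\mathsf{O}$ iff $\mathsf{L}\mathbin{;}R\mathbin{;}\mathsf{L}=\mathsf{L}$) and the point axiom (for every $R\neq\mathsf{O}$ there are points $p,q$ with $p\mathbin{;}q^{\top}\subseteq R$). A point is an element $p$ with $p=p\mathbin{;}\mathsf{L}$, $p\mathbin{;}p^{\top}\subseteq\mathsf{I}$ and $\mathsf{I}\subseteq p^{\top}\mathbin{;}p$. Composition binds tighter than $\cup,\cap$; complement and converse bind tighter than composition. $R$ is univalent if $R^{\top}\mathbin{;}R\subseteq\mathsf{I}$ and injective if $R\mathbin{;}R^{\top}\subseteq\mathsf{I}$. $R$ is connected if $R\mathbin{;}\mathsf{L}\mathbin{;}R\subseteq R^*\cup R^{\top*}$; $R$ is a path if it is injective, univalent and connected. A path $R$ is a cycle if $R^*=R^{\top*}$. -}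

module Defs where

open import Level using (Level; suc)
open import Relation.Binary.PropositionalEquality using (_≡_; _≢_)
open import Data.Product using (Σ-syntax; _×_)
open import Function.Bundles using (_⇔_)

record KleeneRelAlg (c : Level) : Set (suc c) where
  field
    B    : Set c
    _∪_  : B → B → B
    _⨾_  : B → B → B
    ~_   : B → B
    _ᵀ   : B → B
    _*   : B → B
    I    : B

  infixl 6 _∪_
  infixl 7 _⨾_
  infix 9 ~_
  infix 10 _ᵀ _*

  _⊆_ : B → B → Set c
  R ⊆ S = R ∪ S ≡ S
  _∩_ : B → B → B
  R ∩ S = ~ (~ R ∪ ~ S)
  L : B
  L = I ∪ ~ I
  O : B
  O = I ∩ ~ I

  IsPoint : B → Set c
  IsPoint p = (p ≡ p ⨾ L) × (p ⨾ p ᵀ ⊆ I) × (I ⊆ p ᵀ ⨾ p)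

  infix 4 _⊆_
  infixl 6 _∩_

  field
    ∪-assoc  : ∀ R S T → (R ∪ S) ∪ T ≡ R ∪ (S ∪ T)
    ∪-comm   : ∀ R S → R ∪ S ≡ S ∪ R
    huntington : ∀ R S → R ≡ ~ (~ R ∪ ~ S) ∪ ~ (~ R ∪ S)
    ⨾-assoc  : ∀ R S T → (R ⨾ S) ⨾ T ≡ R ⨾ (S ⨾ T)
    ⨾-distribʳ : ∀ R S T → (R ∪ S) ⨾ T ≡ R ⨾ T ∪ S ⨾ T
    ⨾-identityʳ : ∀ R → R ⨾ I ≡ R
    ᵀ-involutive : ∀ R → (R ᵀ) ᵀ ≡ R
    ᵀ-∪ : ∀ R S → (R ∪ S) ᵀ ≡ R ᵀ ∪ S ᵀ
    ᵀ-⨾ : ∀ R S → (R ⨾ S) ᵀ ≡ S ᵀ ⨾ R ᵀ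
    schroeder : ∀ R S → R ᵀ ⨾ ~ (R ⨾ S) ∪ ~ S ≡ ~ S
    *-unfoldˡ : ∀ R → I ∪ R ⨾ R * ⊆ R *
    *-unfoldʳ : ∀ R → I ∪ R * ⨾ R ⊆ R *
    *-inductˡ : ∀ R S Q → S ∪ R ⨾ Q ⊆ Q → R * ⨾ S ⊆ Q
    *-inductʳ : ∀ R S Q → S ∪ Q ⨾ R ⊆ Q → S ⨾ R * ⊆ Q
    tarski : ∀ R → (R ≢ O) ⇔ (L ⨾ R ⨾ L ≡ L)
    point-axiom : ∀ R → R ≢ O → Σ[ p ∈ B ] Σ[ q ∈ B ]
                    (IsPoint p × IsPoint q × p ⨾ q ᵀ ⊆ R)

  _⁺ : B → B
  R ⁺ = R ⨾ R *

  infix 10 _⁺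

  Univalent : B → Set c
  Univalent R = R ᵀ ⨾ R ⊆ I

  Injective : B → Set c
  Injective R = R ⨾ R ᵀ ⊆ I

  Connected : B → Set c
  Connected R = R ⨾ L ⨾ R ⊆ R * ∪ (R ᵀ) *

  IsPath : B → Set c
  IsPath R = Injective R × Univalent R × Connected R

  IsCycle : B → Set c
  IsCycle R = IsPath R × (R * ≡ (R ᵀ) *)

-- If R is a nonempty cycle, the point axiom yields points p, q with p ⨾ q ᵀ ⊆ R, so
-- q ⊆ R ᵀ ⨾ L; and connectivity together with R * = (R ᵀ) * gives R ᵀ ⨾ L ⨾ R ⊆ R ⁺, hence
-- q ⨾ R ⊆ R ⁺.
--
-- Conversely let p be such a point. Since L = p ᵀ ⨾ p, the hypothesis p ⨾ R ⊆ R ⁺ says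
-- L ⨾ R ⊆ p ᵀ ⨾ R ⁺; transposing it and using p ⊆ R ᵀ ⨾ L gives p ⨾ p ᵀ ⊆ (R ᵀ) * ⨾ R ᵀ, and
-- as p ⨾ p ᵀ ⊆ I this part is contained in its converse: p ⨾ p ᵀ ⊆ R ⁺, the point lies on R.
-- Univalence then gives R ᵀ ⨾ L ⊆ R * ⨾ p (hence R ⨾ L ⊆ R * ⨾ p) and injectivity gives
-- L ⨾ R ⨾ R ᵀ ⊆ p ᵀ ⨾ R *, so every relevant path can be routed through p, and
-- R * ⨾ p ⨾ p ᵀ ⨾ R * ⊆ R * yields both connectivity and R ᵀ ⊆ R *, i.e. R * = (R ᵀ) *.
-- Finally L = p ᵀ ⨾ p ⊆ L ⨾ R ⨾ L, so R ≠ O by the Tarski rule.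
--
-- The Boolean laws are derived from Huntington's axiom: x ∪ ~ x does not depend on x, which
-- forces ~ ~ x = x and then idempotence.

module Submission where

open import Defs
open import Level using (Level; suc)
open import Relation.Binary.PropositionalEquality
open import Data.Product using (Σ-syntax; _×_; _,_; proj₁; proj₂)
open import Function.Bundles using (_⇔_; mk⇔; Equivalence)
open import Algebra.Bundles using (CommutativeSemigroup)
open import Relation.Binary.Bundles using (Preorder)

record HuntingtonAlgebra c : Set (suc c) where
  infixl 6 _∪_
  infix 9 ~_
  field
    B          : Set c
    _∪_        : B → B → B
    ~_         : B → B
    ∪-assoc    : ∀ R S T → (R ∪ S) ∪ T ≡ R ∪ (S ∪ T)
    ∪-comm     : ∀ R S → R ∪ S ≡ S ∪ R
    huntington : ∀ R S → R ≡ ~ (~ R ∪ ~ S) ∪ ~ (~ R ∪ S)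

module HuntingtonProperties {c} (H : HuntingtonAlgebra c) where
  open HuntingtonAlgebra H

  infix 4 _⊆_
  infixl 6 _∩_

  _⊆_ : B → B → Set c
  x ⊆ y = x ∪ y ≡ y

  _∩_ : B → B → B
  x ∩ y = ~ (~ x ∪ ~ y)

  ∪-commutativeSemigroup : CommutativeSemigroup c c
  ∪-commutativeSemigroup = record
    { _≈_ = _≡_
    ; _∙_ = _∪_
    ; isCommutativeSemigroup = record
      { isSemigroup = record
        { isMagma = record { isEquivalence = isEquivalence ; ∙-cong = cong₂ _∪_ }
        ; assoc = ∪-assoc }
      ; comm = ∪-comm } }

  open import Algebra.Properties.CommutativeSemigroup ∪-commutativeSemigroup
    using (interchange; x∙yz≈y∙xz)
  open ≡-Reasoning

  -- Huntington's signature has no constants, so the top element is computed from some y.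
  ⊤⟨_⟩ : B → B
  ⊤⟨ y ⟩ = y ∪ ~ y

  ⊥⟨_⟩ : B → B
  ⊥⟨ y ⟩ = ~ ⊤⟨ y ⟩

  -- Expanding x and ~ x by Huntington's axiom along ~ y, and y and ~ y along ~ x,
  -- produces the same four summands.
  ⊤-invariant : ∀ x y → ⊤⟨ x ⟩ ≡ ⊤⟨ y ⟩
  ⊤-invariant x y = begin
    x ∪ ~ x             ≡⟨ cong₂ _∪_ (huntington x (~ y)) (huntington (~ x) (~ y)) ⟩
    (a ∪ b) ∪ (c′ ∪ d)  ≡⟨ interchange a b c′ d ⟩
    (a ∪ c′) ∪ (b ∪ d)  ≡⟨ ∪-comm _ _ ⟩
    (b ∪ d) ∪ (a ∪ c′)  ≡⟨ cong₂ _∪_ (∪-comm b d) (∪-comm a c′) ⟩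
    (d ∪ b) ∪ (c′ ∪ a)  ≡⟨ cong₂ _∪_ (cong₂ _∪_ (~∪-comm _ _) (~∪-comm _ _))
                                     (cong₂ _∪_ (~∪-comm _ _) (~∪-comm _ _)) ⟩
    (~ (~ y ∪ ~ ~ x) ∪ ~ (~ y ∪ ~ x)) ∪ (~ (~ ~ y ∪ ~ ~ x) ∪ ~ (~ ~ y ∪ ~ x))
                        ≡⟨ cong₂ _∪_ (huntington y (~ x)) (huntington (~ y) (~ x)) ⟨
    y ∪ ~ y             ∎
    where
    a = ~ (~ x ∪ ~ ~ y)
    b = ~ (~ x ∪ ~ y)
    c′ = ~ (~ ~ x ∪ ~ ~ y)
    d = ~ (~ ~ x ∪ ~ y)
    ~∪-comm : ∀ u v → ~ (u ∪ v) ≡ ~ (v ∪ u)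
    ~∪-comm u v = cong ~_ (∪-comm u v)

  ~-involutive : ∀ x → ~ ~ x ≡ x
  ~-involutive x = begin
    ~ ~ x                                    ≡⟨ huntington (~ ~ x) (~ x) ⟩
    ~ (~ ~ ~ x ∪ ~ ~ x) ∪ ~ (~ ~ ~ x ∪ ~ x)  ≡⟨ cong₂ (λ u v → ~ u ∪ ~ v)
                                                     (trans (∪-comm _ _) (⊤-invariant (~ ~ x) (~ x)))
                                                     (∪-comm _ _) ⟩
    ~ (~ x ∪ ~ ~ x) ∪ ~ (~ x ∪ ~ ~ ~ x)  ≡⟨ ∪-comm _ _ ⟩
    ~ (~ x ∪ ~ ~ ~ x) ∪ ~ (~ x ∪ ~ ~ x)  ≡⟨ huntington x (~ ~ x) ⟨
    x                                    ∎

  ⊥∪∩-self : ∀ x y → ⊥⟨ y ⟩ ∪ (x ∩ x) ≡ x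
  ⊥∪∩-self x y = begin
    ⊥⟨ y ⟩ ∪ (x ∩ x)                 ≡⟨ cong (λ u → ~ u ∪ (x ∩ x)) (⊤-invariant (~ x) y) ⟨
    ~ (~ x ∪ ~ ~ x) ∪ ~ (~ x ∪ ~ x)  ≡⟨ huntington x (~ x) ⟨
    x                                ∎

  private
    ⊥∩⊥ : ∀ y → ⊥⟨ y ⟩ ∩ ⊥⟨ y ⟩ ≡ ~ (⊤⟨ y ⟩ ∪ ⊤⟨ y ⟩)
    ⊥∩⊥ y = cong (λ u → ~ (u ∪ u)) (~-involutive ⊤⟨ y ⟩)

  ⊤-idem : ∀ y → ⊤⟨ y ⟩ ∪ ⊤⟨ y ⟩ ≡ ⊤⟨ y ⟩
  ⊤-idem y = begin
    w                            ≡⟨ huntington w o ⟩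
    ~ (~ w ∪ ~ o) ∪ ~ (~ w ∪ o)  ≡⟨ cong₂ (λ u v → ~ u ∪ ~ v) ~w∪~o≡⊤ ~w∪o≡⊥ ⟩
    ~ e ∪ ~ o                    ≡⟨ ∪-comm _ _ ⟩
    ~ o ∪ ~ e                    ≡⟨ cong (_∪ ~ e) (~-involutive e) ⟩
    ⊤⟨ e ⟩                       ≡⟨ ⊤-invariant e y ⟩
    e                            ∎
    where
    e = ⊤⟨ y ⟩
    o = ⊥⟨ y ⟩
    w = e ∪ e
    ~w∪o≡⊥ : ~ w ∪ o ≡ o
    ~w∪o≡⊥ = begin
      ~ w ∪ o      ≡⟨ ∪-comm _ _ ⟩
      o ∪ ~ w      ≡⟨ cong (o ∪_) (⊥∩⊥ y) ⟨
      o ∪ (o ∩ o)  ≡⟨ ⊥∪∩-self o y ⟩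
      o            ∎
    ~w∪~o≡⊤ : ~ w ∪ ~ o ≡ e
    ~w∪~o≡⊤ = begin
      ~ w ∪ ~ o        ≡⟨ cong (~ w ∪_) (trans (~-involutive e) (⊤-invariant y o)) ⟩
      ~ w ∪ (o ∪ ~ o)  ≡⟨ ∪-assoc _ _ _ ⟨
      (~ w ∪ o) ∪ ~ o  ≡⟨ cong (_∪ ~ o) ~w∪o≡⊥ ⟩
      ⊤⟨ o ⟩           ≡⟨ ⊤-invariant o y ⟩
      e                ∎

  ⊥-idem : ∀ y → ⊥⟨ y ⟩ ∪ ⊥⟨ y ⟩ ≡ ⊥⟨ y ⟩
  ⊥-idem y = sym (begin
    ⊥⟨ y ⟩                        ≡⟨ ⊥∪∩-self ⊥⟨ y ⟩ y ⟨
    ⊥⟨ y ⟩ ∪ (⊥⟨ y ⟩ ∩ ⊥⟨ y ⟩)    ≡⟨ cong (⊥⟨ y ⟩ ∪_) (⊥∩⊥ y) ⟩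
    ⊥⟨ y ⟩ ∪ ~ (⊤⟨ y ⟩ ∪ ⊤⟨ y ⟩)  ≡⟨ cong (λ u → ⊥⟨ y ⟩ ∪ ~ u) (⊤-idem y) ⟩
    ⊥⟨ y ⟩ ∪ ⊥⟨ y ⟩               ∎)

  ∪-identityʳ : ∀ x y → x ∪ ⊥⟨ y ⟩ ≡ x
  ∪-identityʳ x y = begin
    x ∪ o              ≡⟨ cong (_∪ o) (⊥∪∩-self x y) ⟨
    (o ∪ (x ∩ x)) ∪ o  ≡⟨ ∪-assoc _ _ _ ⟩
    o ∪ ((x ∩ x) ∪ o)  ≡⟨ x∙yz≈y∙xz _ _ _ ⟩
    (x ∩ x) ∪ (o ∪ o)  ≡⟨ cong ((x ∩ x) ∪_) (⊥-idem y) ⟩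
    (x ∩ x) ∪ o        ≡⟨ ∪-comm _ _ ⟩
    o ∪ (x ∩ x)        ≡⟨ ⊥∪∩-self x y ⟩
    x                  ∎
    where o = ⊥⟨ y ⟩

  ∩-idem : ∀ x → x ∩ x ≡ x
  ∩-idem x = begin
    x ∩ x             ≡⟨ ∪-identityʳ (x ∩ x) x ⟨
    (x ∩ x) ∪ ⊥⟨ x ⟩  ≡⟨ ∪-comm _ _ ⟩
    ⊥⟨ x ⟩ ∪ (x ∩ x)  ≡⟨ ⊥∪∩-self x x ⟩
    x                 ∎

  ∪-idem : ∀ x → x ∪ x ≡ x
  ∪-idem x = begin
    x ∪ x          ≡⟨ ~-involutive _ ⟨
    ~ ~ (x ∪ x)    ≡⟨ cong (λ u → ~ ~ (u ∪ u)) (~-involutive x) ⟨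
    ~ (~ x ∩ ~ x)  ≡⟨ cong ~_ (∩-idem (~ x)) ⟩
    ~ ~ x          ≡⟨ ~-involutive x ⟩
    x              ∎

  ⊆-refl : ∀ {x} → x ⊆ x
  ⊆-refl {x} = ∪-idem x

  ⊆-reflexive : ∀ {x y} → x ≡ y → x ⊆ y
  ⊆-reflexive refl = ⊆-refl

  ⊆-trans : ∀ {x y z} → x ⊆ y → y ⊆ z → x ⊆ z
  ⊆-trans {x} {y} {z} x⊆y y⊆z = begin
    x ∪ z        ≡⟨ cong (x ∪_) y⊆z ⟨
    x ∪ (y ∪ z)  ≡⟨ ∪-assoc x y z ⟨
    (x ∪ y) ∪ z  ≡⟨ cong (_∪ z) x⊆y ⟩
    y ∪ z        ≡⟨ y⊆z ⟩
    z            ∎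

  ⊆-antisym : ∀ {x y} → x ⊆ y → y ⊆ x → x ≡ y
  ⊆-antisym {x} {y} x⊆y y⊆x = trans (sym y⊆x) (trans (∪-comm y x) x⊆y)

  ⊆-preorder : Preorder c c c
  ⊆-preorder = record
    { _≈_ = _≡_
    ; _≲_ = _⊆_
    ; isPreorder = record { isEquivalence = isEquivalence ; reflexive = ⊆-reflexive ; trans = ⊆-trans } }

  module ⊆-Reasoning where
    open import Relation.Binary.Reasoning.Preorder ⊆-preorder public
      using (begin_; _∎; step-≡-⟩; step-≡-⟨; _IsRelatedTo_; ≲-go)
    open import Relation.Binary.Reasoning.Syntax using (module ⊆-syntax)
    open ⊆-syntax _IsRelatedTo_ _IsRelatedTo_ ≲-go public

  ∪-upperˡ : ∀ x y → x ⊆ x ∪ y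
  ∪-upperˡ x y = trans (sym (∪-assoc x x y)) (cong (_∪ y) (∪-idem x))

  ∪-upperʳ : ∀ x y → y ⊆ x ∪ y
  ∪-upperʳ x y = subst (y ⊆_) (∪-comm y x) (∪-upperˡ y x)

  ∪-lub : ∀ {x y z} → x ⊆ z → y ⊆ z → x ∪ y ⊆ z
  ∪-lub {x} {y} {z} x⊆z y⊆z = trans (∪-assoc x y z) (trans (cong (x ∪_) y⊆z) x⊆z)

  ∪-mono : ∀ {x x′ y y′} → x ⊆ x′ → y ⊆ y′ → x ∪ y ⊆ x′ ∪ y′
  ∪-mono {x′ = x′} {y′ = y′} x⊆x′ y⊆y′ =
    ∪-lub (⊆-trans x⊆x′ (∪-upperˡ x′ y′)) (⊆-trans y⊆y′ (∪-upperʳ x′ y′))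

  ⊆-⊤ : ∀ x y → x ⊆ ⊤⟨ y ⟩
  ⊆-⊤ x y = begin
    x ∪ ⊤⟨ y ⟩     ≡⟨ cong (x ∪_) (⊤-invariant x y) ⟨
    x ∪ (x ∪ ~ x)  ≡⟨ ∪-upperˡ x (~ x) ⟩
    ⊤⟨ x ⟩         ≡⟨ ⊤-invariant x y ⟩
    ⊤⟨ y ⟩         ∎

  ⊥-⊆ : ∀ x y → ⊥⟨ y ⟩ ⊆ x
  ⊥-⊆ x y = trans (∪-comm _ x) (∪-identityʳ x y)

  ~-antitone : ∀ {x y} → x ⊆ y → ~ y ⊆ ~ x
  ~-antitone {x} {y} x⊆y = begin
    ~ y ∪ ~ x                  ≡⟨ cong (~ y ∪_) ~x-split ⟩
    ~ y ∪ (~ (x ∪ ~ y) ∪ ~ y)  ≡⟨ ∪-upperʳ (~ (x ∪ ~ y)) (~ y) ⟩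
    ~ (x ∪ ~ y) ∪ ~ y          ≡⟨ ~x-split ⟨
    ~ x                        ∎
    where
    ~x-split : ~ x ≡ ~ (x ∪ ~ y) ∪ ~ y
    ~x-split = begin
      ~ x                              ≡⟨ huntington (~ x) y ⟩
      ~ (~ ~ x ∪ ~ y) ∪ ~ (~ ~ x ∪ y)  ≡⟨ cong (λ u → ~ (u ∪ ~ y) ∪ ~ (u ∪ y)) (~-involutive x) ⟩
      ~ (x ∪ ~ y) ∪ ~ (x ∪ y)          ≡⟨ cong (λ u → ~ (x ∪ ~ y) ∪ ~ u) x⊆y ⟩
      ~ (x ∪ ~ y) ∪ ~ y                ∎

  ∩-lowerˡ : ∀ x y → x ∩ y ⊆ x
  ∩-lowerˡ x y = subst (x ∩ y ⊆_) (~-involutive x) (~-antitone (∪-upperˡ (~ x) (~ y)))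

  ∩-lowerʳ : ∀ x y → x ∩ y ⊆ y
  ∩-lowerʳ x y = subst (x ∩ y ⊆_) (~-involutive y) (~-antitone (∪-upperʳ (~ x) (~ y)))

  ∩-glb : ∀ {x y z} → z ⊆ x → z ⊆ y → z ⊆ x ∩ y
  ∩-glb {z = z} z⊆x z⊆y = subst (_⊆ _) (~-involutive z) (~-antitone (∪-lub (~-antitone z⊆x) (~-antitone z⊆y)))

  shunting : ∀ {x y t} → x ⊆ y ∪ ~ t → x ∩ t ⊆ y
  shunting {x} {y} {t} x⊆y∪~t =
    ⊆-trans (⊆-reflexive (huntington a y))
            (∪-lub (∩-lowerʳ a y) (⊆-trans (~-antitone ⊤⊆~a∪y) (⊥-⊆ y (y ∪ ~ t))))
    where
    a = x ∩ t
    ⊤⊆~a∪y : ⊤⟨ y ∪ ~ t ⟩ ⊆ ~ a ∪ y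
    ⊤⊆~a∪y = ∪-lub (∪-lub (∪-upperʳ (~ a) y) (⊆-trans (~-antitone (∩-lowerʳ x t)) (∪-upperˡ (~ a) y)))
                   (⊆-trans (~-antitone x⊆y∪~t) (⊆-trans (~-antitone (∩-lowerˡ x t)) (∪-upperˡ (~ a) y)))

huntingtonAlgebra : ∀ {c} → KleeneRelAlg c → HuntingtonAlgebra c
huntingtonAlgebra K = record { KleeneRelAlg K }

module KleeneRelAlgProperties {c} (K : KleeneRelAlg c) where
  open KleeneRelAlg K
  open HuntingtonProperties (huntingtonAlgebra K) hiding (_⊆_; _∩_)

  ᵀ-mono : ∀ {S T} → S ⊆ T → S ᵀ ⊆ T ᵀ
  ᵀ-mono {S} {T} S⊆T = trans (sym (ᵀ-∪ S T)) (cong _ᵀ S⊆T)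

  ᵀ-⨾-ᵀ : ∀ R S → (S ᵀ ⨾ R ᵀ) ᵀ ≡ R ⨾ S
  ᵀ-⨾-ᵀ R S = trans (ᵀ-⨾ (S ᵀ) (R ᵀ)) (cong₂ _⨾_ (ᵀ-involutive R) (ᵀ-involutive S))

  ⨾-distribˡ : ∀ R S T → R ⨾ (S ∪ T) ≡ R ⨾ S ∪ R ⨾ T
  ⨾-distribˡ R S T = begin
    R ⨾ (S ∪ T)                    ≡⟨ ᵀ-⨾-ᵀ R (S ∪ T) ⟨
    ((S ∪ T) ᵀ ⨾ R ᵀ) ᵀ            ≡⟨ cong (λ U → (U ⨾ R ᵀ) ᵀ) (ᵀ-∪ S T) ⟩
    ((S ᵀ ∪ T ᵀ) ⨾ R ᵀ) ᵀ          ≡⟨ cong _ᵀ (⨾-distribʳ (S ᵀ) (T ᵀ) (R ᵀ)) ⟩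
    (S ᵀ ⨾ R ᵀ ∪ T ᵀ ⨾ R ᵀ) ᵀ      ≡⟨ ᵀ-∪ _ _ ⟩
    (S ᵀ ⨾ R ᵀ) ᵀ ∪ (T ᵀ ⨾ R ᵀ) ᵀ  ≡⟨ cong₂ _∪_ (ᵀ-⨾-ᵀ R S) (ᵀ-⨾-ᵀ R T) ⟩
    R ⨾ S ∪ R ⨾ T                  ∎
    where open ≡-Reasoning

  ⨾-monoˡ : ∀ {S T} R → S ⊆ T → S ⨾ R ⊆ T ⨾ R
  ⨾-monoˡ {S} {T} R S⊆T = trans (sym (⨾-distribʳ S T R)) (cong (_⨾ R) S⊆T)

  ⨾-monoʳ : ∀ {S T} R → S ⊆ T → R ⨾ S ⊆ R ⨾ T
  ⨾-monoʳ {S} {T} R S⊆T = trans (sym (⨾-distribˡ R S T)) (cong (R ⨾_) S⊆T)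

  ⨾-mono : ∀ {R R′ S S′} → R ⊆ R′ → S ⊆ S′ → R ⨾ S ⊆ R′ ⨾ S′
  ⨾-mono {R′ = R′} {S = S} R⊆R′ S⊆S′ = ⊆-trans (⨾-monoˡ S R⊆R′) (⨾-monoʳ R′ S⊆S′)

  ᵀ-identity : I ᵀ ≡ I
  ᵀ-identity = begin
    I ᵀ          ≡⟨ ⨾-identityʳ (I ᵀ) ⟨
    I ᵀ ⨾ I      ≡⟨ cong (I ᵀ ⨾_) (ᵀ-involutive I) ⟨
    I ᵀ ⨾ I ᵀ ᵀ  ≡⟨ ᵀ-⨾ (I ᵀ) I ⟨
    (I ᵀ ⨾ I) ᵀ  ≡⟨ cong _ᵀ (⨾-identityʳ (I ᵀ)) ⟩
    I ᵀ ᵀ        ≡⟨ ᵀ-involutive I ⟩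
    I            ∎
    where open ≡-Reasoning

  ⨾-identityˡ : ∀ R → I ⨾ R ≡ R
  ⨾-identityˡ R = begin
    I ⨾ R          ≡⟨ ᵀ-⨾-ᵀ I R ⟨
    (R ᵀ ⨾ I ᵀ) ᵀ  ≡⟨ cong (λ U → (R ᵀ ⨾ U) ᵀ) ᵀ-identity ⟩
    (R ᵀ ⨾ I) ᵀ    ≡⟨ cong _ᵀ (⨾-identityʳ (R ᵀ)) ⟩
    R ᵀ ᵀ          ≡⟨ ᵀ-involutive R ⟩
    R              ∎
    where open ≡-Reasoning

  ᵀ-L : L ᵀ ≡ L
  ᵀ-L = ⊆-antisym (⊆-⊤ (L ᵀ) I) (subst (_⊆ L ᵀ) (ᵀ-involutive L) (ᵀ-mono (⊆-⊤ (L ᵀ) I)))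

  ⨾⊆⨾L⨾ : ∀ R S → R ⨾ S ⊆ R ⨾ L ⨾ S
  ⨾⊆⨾L⨾ R S = begin
    R ⨾ S      ≡⟨ cong (_⨾ S) (⨾-identityʳ R) ⟨
    R ⨾ I ⨾ S  ⊆⟨ ⨾-monoˡ S (⨾-monoʳ R (⊆-⊤ I I)) ⟩
    R ⨾ L ⨾ S  ∎
    where open ⊆-Reasoning

  schroeder-⊆ : ∀ R T → R ⨾ ~ (R ᵀ ⨾ T) ⊆ ~ T
  schroeder-⊆ R T = subst (λ U → U ⨾ ~ (R ᵀ ⨾ T) ⊆ ~ T) (ᵀ-involutive R) (schroeder (R ᵀ) T)

  dedekind : ∀ R S T → R ⨾ S ∩ T ⊆ R ⨾ (S ∩ R ᵀ ⨾ T)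
  dedekind R S T = shunting (begin
    R ⨾ S                          ≡⟨ cong (R ⨾_) (huntington S A) ⟩
    R ⨾ ((S ∩ A) ∪ ~ (~ S ∪ A))    ≡⟨ ⨾-distribˡ R (S ∩ A) _ ⟩
    R ⨾ (S ∩ A) ∪ R ⨾ ~ (~ S ∪ A)  ⊆⟨ ∪-mono ⊆-refl R⨾~[~S∪A]⊆~T ⟩
    R ⨾ (S ∩ A) ∪ ~ T              ∎)
    where
    open ⊆-Reasoning
    A = R ᵀ ⨾ T
    R⨾~[~S∪A]⊆~T : R ⨾ ~ (~ S ∪ A) ⊆ ~ T
    R⨾~[~S∪A]⊆~T = ⊆-trans (⨾-monoʳ R (~-antitone (∪-upperʳ (~ S) A))) (schroeder-⊆ R T)

  ⨾L⨾⊆⨾L : ∀ R S → R ⨾ L ⨾ S ⊆ R ⨾ L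
  ⨾L⨾⊆⨾L R S = subst (_⊆ R ⨾ L) (sym (⨾-assoc R L S)) (⨾-monoʳ R (⊆-⊤ (L ⨾ S) I))

  ⊆⨾ᵀ⨾ : ∀ R → R ⊆ R ⨾ R ᵀ ⨾ R
  ⊆⨾ᵀ⨾ R = begin
    R                  ⊆⟨ ∩-glb (⊆-reflexive (sym (⨾-identityʳ R))) ⊆-refl ⟩
    R ⨾ I ∩ R          ⊆⟨ dedekind R I R ⟩
    R ⨾ (I ∩ R ᵀ ⨾ R)  ⊆⟨ ⨾-monoʳ R (∩-lowerʳ I (R ᵀ ⨾ R)) ⟩
    R ⨾ (R ᵀ ⨾ R)      ≡⟨ ⨾-assoc R (R ᵀ) R ⟨
    R ⨾ R ᵀ ⨾ R        ∎
    where open ⊆-Reasoning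

  ∩I⊆ᵀ : ∀ R → R ∩ I ⊆ R ᵀ
  ∩I⊆ᵀ R = begin
    S            ⊆⟨ ⊆⨾ᵀ⨾ S ⟩
    S ⨾ S ᵀ ⨾ S  ⊆⟨ ⨾-mono (⨾-monoˡ (S ᵀ) (∩-lowerʳ R I)) (∩-lowerʳ R I) ⟩
    I ⨾ S ᵀ ⨾ I  ≡⟨ trans (⨾-identityʳ _) (⨾-identityˡ _) ⟩
    S ᵀ          ⊆⟨ ᵀ-mono (∩-lowerˡ R I) ⟩
    R ᵀ          ∎
    where
    open ⊆-Reasoning
    S = R ∩ I

  *-refl : ∀ R → I ⊆ R *
  *-refl R = ⊆-trans (∪-upperˡ I (R ⁺)) (*-unfoldˡ R)

  ⁺⊆* : ∀ R → R ⁺ ⊆ R *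
  ⁺⊆* R = ⊆-trans (∪-upperʳ I (R ⁺)) (*-unfoldˡ R)

  *⨾⊆* : ∀ R → R * ⨾ R ⊆ R *
  *⨾⊆* R = ⊆-trans (∪-upperʳ I (R * ⨾ R)) (*-unfoldʳ R)

  *-induct : ∀ R {Q} → I ⊆ Q → R ⨾ Q ⊆ Q → R * ⊆ Q
  *-induct R {Q} I⊆Q RQ⊆Q = subst (_⊆ Q) (⨾-identityʳ (R *)) (*-inductˡ R I Q (∪-lub I⊆Q RQ⊆Q))

  *-trans : ∀ R → R * ⨾ R * ⊆ R *
  *-trans R = *-inductˡ R (R *) (R *) (∪-lub ⊆-refl (⁺⊆* R))

  *-least : ∀ {R S} → S ⊆ R * → S * ⊆ R *
  *-least {R} {S} S⊆R* = *-induct S (*-refl R) (⊆-trans (⨾-monoˡ (R *) S⊆R*) (*-trans R))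

  *⨾⊆⁺ : ∀ R → R * ⨾ R ⊆ R ⁺
  *⨾⊆⁺ R = *-inductˡ R R (R ⁺) (∪-lub R⊆R⁺ (⨾-monoʳ R (⁺⊆* R)))
    where
    R⊆R⁺ : R ⊆ R ⁺
    R⊆R⁺ = subst (_⊆ R ⁺) (⨾-identityʳ R) (⨾-monoʳ R (*-refl R))

  ⁺⊆*⨾ : ∀ R → R ⁺ ⊆ R * ⨾ R
  ⁺⊆*⨾ R = *-inductʳ R R (R * ⨾ R) (∪-lub R⊆*R (⨾-monoˡ R (*⨾⊆* R)))
    where
    R⊆*R : R ⊆ R * ⨾ R
    R⊆*R = subst (_⊆ R * ⨾ R) (⨾-identityˡ R) (⨾-monoˡ R (*-refl R))

  *-ᵀ : ∀ R → (R *) ᵀ ⊆ (R ᵀ) *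
  *-ᵀ R = subst ((R *) ᵀ ⊆_) (ᵀ-involutive ((R ᵀ) *)) (ᵀ-mono R*⊆ᵀ*ᵀ)
    where
    R*⊆ᵀ*ᵀ : R * ⊆ ((R ᵀ) *) ᵀ
    R*⊆ᵀ*ᵀ = *-induct R (subst (_⊆ ((R ᵀ) *) ᵀ) ᵀ-identity (ᵀ-mono (*-refl (R ᵀ)))) (begin
      R ⨾ ((R ᵀ) *) ᵀ        ≡⟨ cong (_⨾ ((R ᵀ) *) ᵀ) (ᵀ-involutive R) ⟨
      R ᵀ ᵀ ⨾ ((R ᵀ) *) ᵀ    ≡⟨ ᵀ-⨾ ((R ᵀ) *) (R ᵀ) ⟨
      ((R ᵀ) * ⨾ R ᵀ) ᵀ      ⊆⟨ ᵀ-mono (*⨾⊆* (R ᵀ)) ⟩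
      ((R ᵀ) *) ᵀ            ∎)
      where open ⊆-Reasoning

  ᵀ*-ᵀ : ∀ R → ((R ᵀ) *) ᵀ ⊆ R *
  ᵀ*-ᵀ R = subst (λ S → ((R ᵀ) *) ᵀ ⊆ S *) (ᵀ-involutive R) (*-ᵀ (R ᵀ))

  ᵀ⊆*⇒*≡ᵀ* : ∀ {R} → R ᵀ ⊆ R * → R * ≡ (R ᵀ) *
  ᵀ⊆*⇒*≡ᵀ* {R} Rᵀ⊆R* = ⊆-antisym (*-least R⊆ᵀ*) (*-least Rᵀ⊆R*)
    where
    R⊆ᵀ* : R ⊆ (R ᵀ) *
    R⊆ᵀ* = subst (_⊆ (R ᵀ) *) (ᵀ-involutive R) (⊆-trans (ᵀ-mono Rᵀ⊆R*) (*-ᵀ R))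

  ⁺-ᵀ : ∀ R → (R ⁺) ᵀ ⊆ (R ᵀ) * ⨾ R ᵀ
  ⁺-ᵀ R = subst (_⊆ (R ᵀ) * ⨾ R ᵀ) (sym (ᵀ-⨾ R (R *))) (⨾-monoˡ (R ᵀ) (*-ᵀ R))

  *⨾⊆⁺⨾ : ∀ {R P} → P ⊆ R ⁺ ⨾ P → R * ⨾ P ⊆ R ⁺ ⨾ P
  *⨾⊆⁺⨾ {R} {P} P⊆R⁺P = *-inductˡ R P (R ⁺ ⨾ P) (∪-lub P⊆R⁺P (begin
    R ⨾ (R ⁺ ⨾ P)  ≡⟨ ⨾-assoc R (R ⁺) P ⟨
    R ⨾ R ⁺ ⨾ P    ⊆⟨ ⨾-monoˡ P (⨾-monoʳ R (⁺⊆* R)) ⟩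
    R ⁺ ⨾ P        ∎))
    where open ⊆-Reasoning

  univalent⇒ᵀ⨾⁺⊆* : ∀ {R} → Univalent R → R ᵀ ⨾ R ⁺ ⊆ R *
  univalent⇒ᵀ⨾⁺⊆* {R} univalent = begin
    R ᵀ ⨾ (R ⨾ R *)  ≡⟨ ⨾-assoc (R ᵀ) R (R *) ⟨
    R ᵀ ⨾ R ⨾ R *    ⊆⟨ ⨾-monoˡ (R *) univalent ⟩
    I ⨾ R *          ≡⟨ ⨾-identityˡ (R *) ⟩
    R *              ∎
    where open ⊆-Reasoning

  injective⇒⁺⨾ᵀ⊆* : ∀ {R} → Injective R → R ⁺ ⨾ R ᵀ ⊆ R *
  injective⇒⁺⨾ᵀ⊆* {R} injective = begin
    R ⁺ ⨾ R ᵀ        ⊆⟨ ⨾-monoˡ (R ᵀ) (⁺⊆*⨾ R) ⟩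
    R * ⨾ R ⨾ R ᵀ    ≡⟨ ⨾-assoc (R *) R (R ᵀ) ⟩
    R * ⨾ (R ⨾ R ᵀ)  ⊆⟨ ⨾-monoʳ (R *) injective ⟩
    R * ⨾ I          ≡⟨ ⨾-identityʳ (R *) ⟩
    R *              ∎
    where open ⊆-Reasoning

  L⊆pointᵀ⨾point : ∀ {p} → IsPoint p → L ⊆ p ᵀ ⨾ p
  L⊆pointᵀ⨾point {p} (p≡pL , _ , I⊆pᵀp) = begin
    L              ≡⟨ ⨾-identityˡ L ⟨
    I ⨾ L          ⊆⟨ ⨾-monoˡ L I⊆pᵀp ⟩
    p ᵀ ⨾ p ⨾ L    ≡⟨ ⨾-assoc (p ᵀ) p L ⟩
    p ᵀ ⨾ (p ⨾ L)  ≡⟨ cong (p ᵀ ⨾_) p≡pL ⟨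
    p ᵀ ⨾ p        ∎
    where open ⊆-Reasoning

  surjective⇒⊆ᵀ⨾L : ∀ {R p q} → I ⊆ p ᵀ ⨾ p → p ⨾ q ᵀ ⊆ R → q ⊆ R ᵀ ⨾ L
  surjective⇒⊆ᵀ⨾L {R} {p} {q} I⊆pᵀp pqᵀ⊆R = begin
    q              ≡⟨ ⨾-identityʳ q ⟨
    q ⨾ I          ⊆⟨ ⨾-monoʳ q I⊆pᵀp ⟩
    q ⨾ (p ᵀ ⨾ p)  ≡⟨ ⨾-assoc q (p ᵀ) p ⟨
    q ⨾ p ᵀ ⨾ p    ⊆⟨ ⨾-mono qpᵀ⊆Rᵀ (⊆-⊤ p I) ⟩
    R ᵀ ⨾ L        ∎
    where
    open ⊆-Reasoning
    qpᵀ⊆Rᵀ : q ⨾ p ᵀ ⊆ R ᵀ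
    qpᵀ⊆Rᵀ = subst (_⊆ R ᵀ) (trans (ᵀ-⨾ p (q ᵀ)) (cong (_⨾ p ᵀ) (ᵀ-involutive q))) (ᵀ-mono pqᵀ⊆R)

  connected-cycle⇒ᵀ⨾L⨾ᵀ⊆* : ∀ {R} → Connected R → R * ≡ (R ᵀ) * → R ᵀ ⨾ L ⨾ R ᵀ ⊆ R *
  connected-cycle⇒ᵀ⨾L⨾ᵀ⊆* {R} connected R*≡Rᵀ* = begin
    R ᵀ ⨾ L ⨾ R ᵀ      ≡⟨ cong (λ U → R ᵀ ⨾ U ⨾ R ᵀ) ᵀ-L ⟨
    R ᵀ ⨾ L ᵀ ⨾ R ᵀ    ≡⟨ ⨾-assoc (R ᵀ) (L ᵀ) (R ᵀ) ⟩
    R ᵀ ⨾ (L ᵀ ⨾ R ᵀ)  ≡⟨ cong (R ᵀ ⨾_) (ᵀ-⨾ R L) ⟨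
    R ᵀ ⨾ (R ⨾ L) ᵀ    ≡⟨ ᵀ-⨾ (R ⨾ L) R ⟨
    (R ⨾ L ⨾ R) ᵀ      ⊆⟨ ᵀ-mono connected ⟩
    (R * ∪ (R ᵀ) *) ᵀ  ≡⟨ cong (λ U → (R * ∪ U) ᵀ) R*≡Rᵀ* ⟨
    (R * ∪ R *) ᵀ      ≡⟨ cong _ᵀ (∪-idem (R *)) ⟩
    (R *) ᵀ            ⊆⟨ *-ᵀ R ⟩
    (R ᵀ) *            ≡⟨ R*≡Rᵀ* ⟨
    R *                ∎
    where open ⊆-Reasoning

  connected-cycle⇒ᵀ⨾L⨾⊆⁺ : ∀ {R} → Connected R → R * ≡ (R ᵀ) * → R ᵀ ⨾ L ⨾ R ⊆ R ⁺
  connected-cycle⇒ᵀ⨾L⨾⊆⁺ {R} connected R*≡Rᵀ* = begin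
    R ᵀ ⨾ L ⨾ R                ⊆⟨ ⨾-monoʳ (R ᵀ ⨾ L) (⊆⨾ᵀ⨾ R) ⟩
    R ᵀ ⨾ L ⨾ (R ⨾ R ᵀ ⨾ R)    ≡⟨ cong (R ᵀ ⨾ L ⨾_) (⨾-assoc R (R ᵀ) R) ⟩
    R ᵀ ⨾ L ⨾ (R ⨾ (R ᵀ ⨾ R))  ≡⟨ ⨾-assoc (R ᵀ ⨾ L) R (R ᵀ ⨾ R) ⟨
    R ᵀ ⨾ L ⨾ R ⨾ (R ᵀ ⨾ R)    ≡⟨ ⨾-assoc (R ᵀ ⨾ L ⨾ R) (R ᵀ) R ⟨
    R ᵀ ⨾ L ⨾ R ⨾ R ᵀ ⨾ R      ⊆⟨ ⨾-monoˡ R (⨾-monoˡ (R ᵀ) (⨾L⨾⊆⨾L (R ᵀ) R)) ⟩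
    R ᵀ ⨾ L ⨾ R ᵀ ⨾ R          ⊆⟨ ⨾-monoˡ R (connected-cycle⇒ᵀ⨾L⨾ᵀ⊆* connected R*≡Rᵀ*) ⟩
    R * ⨾ R                    ⊆⟨ *⨾⊆⁺ R ⟩
    R ⁺                        ∎
    where open ⊆-Reasoning

  point-of-nonempty-cycle : ∀ {R} → IsCycle R → R ≢ O →
                            Σ[ q ∈ B ] (IsPoint q × q ⨾ R ⊆ R ⁺ × q ⊆ R ᵀ ⨾ L)
  point-of-nonempty-cycle {R} ((_ , _ , connected) , R*≡Rᵀ*) R≢O
    with point-axiom R R≢O
  ... | p , q , (_ , _ , I⊆pᵀp) , q-point , pqᵀ⊆R = q , q-point , qR⊆R⁺ , q⊆RᵀL
    where
    q⊆RᵀL : q ⊆ R ᵀ ⨾ L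
    q⊆RᵀL = surjective⇒⊆ᵀ⨾L I⊆pᵀp pqᵀ⊆R
    qR⊆R⁺ : q ⨾ R ⊆ R ⁺
    qR⊆R⁺ = ⊆-trans (⨾-monoˡ R q⊆RᵀL) (connected-cycle⇒ᵀ⨾L⨾⊆⁺ connected R*≡Rᵀ*)

  module CycleFromPoint {R p : B} (injective : Injective R) (univalent : Univalent R) (p-point : IsPoint p)
                        (pR⊆R⁺ : p ⨾ R ⊆ R ⁺) (p⊆RᵀL : p ⊆ R ᵀ ⨾ L) where
    open ⊆-Reasoning

    p⨾pᵀ⊆I : p ⨾ p ᵀ ⊆ I
    p⨾pᵀ⊆I = proj₁ (proj₂ p-point)

    L⨾R⊆pᵀ⨾R⁺ : L ⨾ R ⊆ p ᵀ ⨾ R ⁺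
    L⨾R⊆pᵀ⨾R⁺ = begin
      L ⨾ R          ⊆⟨ ⨾-monoˡ R (L⊆pointᵀ⨾point p-point) ⟩
      p ᵀ ⨾ p ⨾ R    ≡⟨ ⨾-assoc (p ᵀ) p R ⟩
      p ᵀ ⨾ (p ⨾ R)  ⊆⟨ ⨾-monoʳ (p ᵀ) pR⊆R⁺ ⟩
      p ᵀ ⨾ R ⁺      ∎

    Rᵀ⨾L⊆Rᵀ*⨾Rᵀ⨾p : R ᵀ ⨾ L ⊆ (R ᵀ) * ⨾ R ᵀ ⨾ p
    Rᵀ⨾L⊆Rᵀ*⨾Rᵀ⨾p = begin
      R ᵀ ⨾ L            ≡⟨ cong (R ᵀ ⨾_) ᵀ-L ⟨
      R ᵀ ⨾ L ᵀ          ≡⟨ ᵀ-⨾ L R ⟨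
      (L ⨾ R) ᵀ          ⊆⟨ ᵀ-mono L⨾R⊆pᵀ⨾R⁺ ⟩
      (p ᵀ ⨾ R ⁺) ᵀ      ≡⟨ trans (ᵀ-⨾ (p ᵀ) (R ⁺)) (cong ((R ⁺) ᵀ ⨾_) (ᵀ-involutive p)) ⟩
      (R ⁺) ᵀ ⨾ p        ⊆⟨ ⨾-monoˡ p (⁺-ᵀ R) ⟩
      (R ᵀ) * ⨾ R ᵀ ⨾ p  ∎

    p⨾pᵀ⊆R⁺ : p ⨾ p ᵀ ⊆ R ⁺
    p⨾pᵀ⊆R⁺ = begin
      p ⨾ p ᵀ          ⊆⟨ ∩-glb p⨾pᵀ⊆S p⨾pᵀ⊆I ⟩
      S ∩ I            ⊆⟨ ∩I⊆ᵀ S ⟩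
      S ᵀ              ≡⟨ trans (ᵀ-⨾ ((R ᵀ) *) (R ᵀ)) (cong (_⨾ ((R ᵀ) *) ᵀ) (ᵀ-involutive R)) ⟩
      R ⨾ ((R ᵀ) *) ᵀ  ⊆⟨ ⨾-monoʳ R (ᵀ*-ᵀ R) ⟩
      R ⁺              ∎
      where
      S = (R ᵀ) * ⨾ R ᵀ
      p⨾pᵀ⊆S : p ⨾ p ᵀ ⊆ S
      p⨾pᵀ⊆S = begin
        p ⨾ p ᵀ        ⊆⟨ ⨾-monoˡ (p ᵀ) (⊆-trans p⊆RᵀL Rᵀ⨾L⊆Rᵀ*⨾Rᵀ⨾p) ⟩
        S ⨾ p ⨾ p ᵀ    ≡⟨ ⨾-assoc S p (p ᵀ) ⟩
        S ⨾ (p ⨾ p ᵀ)  ⊆⟨ ⨾-monoʳ S p⨾pᵀ⊆I ⟩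
        S ⨾ I          ≡⟨ ⨾-identityʳ S ⟩
        S              ∎

    Rᵀ*⨾p⊆R*⨾p : (R ᵀ) * ⨾ p ⊆ R * ⨾ p
    Rᵀ*⨾p⊆R*⨾p = *-inductˡ (R ᵀ) p (R * ⨾ p) (∪-lub p⊆R*⨾p (begin
      R ᵀ ⨾ (R * ⨾ p)  ⊆⟨ ⨾-monoʳ (R ᵀ) (*⨾⊆⁺⨾ p⊆R⁺⨾p) ⟩
      R ᵀ ⨾ (R ⁺ ⨾ p)  ≡⟨ ⨾-assoc (R ᵀ) (R ⁺) p ⟨
      R ᵀ ⨾ R ⁺ ⨾ p    ⊆⟨ ⨾-monoˡ p (univalent⇒ᵀ⨾⁺⊆* univalent) ⟩
      R * ⨾ p          ∎))
      where
      p⊆R*⨾p : p ⊆ R * ⨾ p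
      p⊆R*⨾p = subst (_⊆ R * ⨾ p) (⨾-identityˡ p) (⨾-monoˡ p (*-refl R))
      p⊆R⁺⨾p : p ⊆ R ⁺ ⨾ p
      p⊆R⁺⨾p = begin
        p            ⊆⟨ ⊆⨾ᵀ⨾ p ⟩
        p ⨾ p ᵀ ⨾ p  ⊆⟨ ⨾-monoˡ p p⨾pᵀ⊆R⁺ ⟩
        R ⁺ ⨾ p      ∎

    Rᵀ⨾L⊆R*⨾p : R ᵀ ⨾ L ⊆ R * ⨾ p
    Rᵀ⨾L⊆R*⨾p = begin
      R ᵀ ⨾ L            ⊆⟨ Rᵀ⨾L⊆Rᵀ*⨾Rᵀ⨾p ⟩
      (R ᵀ) * ⨾ R ᵀ ⨾ p  ⊆⟨ ⨾-monoˡ p (*⨾⊆* (R ᵀ)) ⟩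
      (R ᵀ) * ⨾ p        ⊆⟨ Rᵀ*⨾p⊆R*⨾p ⟩
      R * ⨾ p            ∎

    R⨾L⊆R*⨾p : R ⨾ L ⊆ R * ⨾ p
    R⨾L⊆R*⨾p = begin
      R ⨾ L                ⊆⟨ ⨾-monoˡ L (⊆⨾ᵀ⨾ R) ⟩
      R ⨾ R ᵀ ⨾ R ⨾ L      ≡⟨ trans (⨾-assoc (R ⨾ R ᵀ) R L) (⨾-assoc R (R ᵀ) (R ⨾ L)) ⟩
      R ⨾ (R ᵀ ⨾ (R ⨾ L))  ⊆⟨ ⨾-monoʳ R (⨾-monoʳ (R ᵀ) (⊆-⊤ (R ⨾ L) I)) ⟩
      R ⨾ (R ᵀ ⨾ L)        ⊆⟨ ⨾-monoʳ R Rᵀ⨾L⊆R*⨾p ⟩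
      R ⨾ (R * ⨾ p)        ≡⟨ ⨾-assoc R (R *) p ⟨
      R ⁺ ⨾ p              ⊆⟨ ⨾-monoˡ p (⁺⊆* R) ⟩
      R * ⨾ p              ∎

    L⨾R⨾Rᵀ⊆pᵀ⨾R* : L ⨾ R ⨾ R ᵀ ⊆ p ᵀ ⨾ R *
    L⨾R⨾Rᵀ⊆pᵀ⨾R* = begin
      L ⨾ R ⨾ R ᵀ        ⊆⟨ ⨾-monoˡ (R ᵀ) L⨾R⊆pᵀ⨾R⁺ ⟩
      p ᵀ ⨾ R ⁺ ⨾ R ᵀ    ≡⟨ ⨾-assoc (p ᵀ) (R ⁺) (R ᵀ) ⟩
      p ᵀ ⨾ (R ⁺ ⨾ R ᵀ)  ⊆⟨ ⨾-monoʳ (p ᵀ) (injective⇒⁺⨾ᵀ⊆* injective) ⟩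
      p ᵀ ⨾ R *          ∎

    through-p : ∀ {S T} → S ⊆ R * ⨾ p → T ⊆ p ᵀ ⨾ R * → S ⨾ T ⊆ R *
    through-p {S} {T} S⊆R*p T⊆pᵀR* = begin
      S ⨾ T                  ⊆⟨ ⨾-mono S⊆R*p T⊆pᵀR* ⟩
      R * ⨾ p ⨾ (p ᵀ ⨾ R *)  ≡⟨ trans (⨾-assoc (R *) p (p ᵀ ⨾ R *)) (cong (R * ⨾_) (sym (⨾-assoc p (p ᵀ) (R *)))) ⟩
      R * ⨾ (p ⨾ p ᵀ ⨾ R *)  ⊆⟨ ⨾-monoʳ (R *) (⨾-monoˡ (R *) p⨾pᵀ⊆I) ⟩
      R * ⨾ (I ⨾ R *)        ≡⟨ cong (R * ⨾_) (⨾-identityˡ (R *)) ⟩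
      R * ⨾ R *              ⊆⟨ *-trans R ⟩
      R *                    ∎

    Rᵀ⊆R* : R ᵀ ⊆ R *
    Rᵀ⊆R* = begin
      R ᵀ                        ⊆⟨ ⊆⨾ᵀ⨾ (R ᵀ) ⟩
      R ᵀ ⨾ R ᵀ ᵀ ⨾ R ᵀ          ≡⟨ cong (λ U → R ᵀ ⨾ U ⨾ R ᵀ) (ᵀ-involutive R) ⟩
      R ᵀ ⨾ R ⨾ R ᵀ              ⊆⟨ ⨾-monoˡ (R ᵀ) (⊆-trans (⨾⊆⨾L⨾ (R ᵀ) R) (⨾⊆⨾L⨾ (R ᵀ ⨾ L) R)) ⟩
      R ᵀ ⨾ L ⨾ L ⨾ R ⨾ R ᵀ      ≡⟨ trans (⨾-assoc (R ᵀ ⨾ L ⨾ L) R (R ᵀ)) (⨾-assoc (R ᵀ ⨾ L) L (R ⨾ R ᵀ)) ⟩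
      R ᵀ ⨾ L ⨾ (L ⨾ (R ⨾ R ᵀ))  ≡⟨ cong (R ᵀ ⨾ L ⨾_) (⨾-assoc L R (R ᵀ)) ⟨
      R ᵀ ⨾ L ⨾ (L ⨾ R ⨾ R ᵀ)    ⊆⟨ through-p Rᵀ⨾L⊆R*⨾p L⨾R⨾Rᵀ⊆pᵀ⨾R* ⟩
      R *                        ∎

    connected : Connected R
    connected = begin
      R ⨾ L ⨾ R        ⊆⟨ ⨾⊆⨾L⨾ (R ⨾ L) R ⟩
      R ⨾ L ⨾ L ⨾ R    ≡⟨ ⨾-assoc (R ⨾ L) L R ⟩
      R ⨾ L ⨾ (L ⨾ R)  ⊆⟨ through-p R⨾L⊆R*⨾p (⊆-trans L⨾R⊆pᵀ⨾R⁺ (⨾-monoʳ (p ᵀ) (⁺⊆* R))) ⟩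
      R *              ⊆⟨ ∪-upperˡ (R *) ((R ᵀ) *) ⟩
      R * ∪ (R ᵀ) *    ∎

    nonempty : R ≢ O
    nonempty = Equivalence.from (tarski R) (⊆-antisym (⊆-⊤ (L ⨾ R ⨾ L) I) (begin
      L          ⊆⟨ L⊆pointᵀ⨾point p-point ⟩
      p ᵀ ⨾ p    ⊆⟨ ⨾-mono pᵀ⊆L⨾R (⊆-⊤ p I) ⟩
      L ⨾ R ⨾ L  ∎))
      where
      pᵀ⊆L⨾R : p ᵀ ⊆ L ⨾ R
      pᵀ⊆L⨾R = subst (p ᵀ ⊆_) (trans (ᵀ-⨾ (R ᵀ) L) (cong₂ _⨾_ ᵀ-L (ᵀ-involutive R))) (ᵀ-mono p⊆RᵀL)

    nonempty-cycle : IsCycle R × R ≢ O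
    nonempty-cycle = ((injective , univalent , connected) , ᵀ⊆*⇒*≡ᵀ* Rᵀ⊆R*) , nonempty

mainTheorem18 : ∀ {c : Level} (K : KleeneRelAlg c) → let open KleeneRelAlg K in
    ∀ (R : B) → Injective R → Univalent R →
    ((IsCycle R × R ≢ O) ⇔ (Σ[ p ∈ B ] (IsPoint p × p ⨾ R ⊆ R ⁺ × p ⊆ R ᵀ ⨾ L)))
mainTheorem18 K R injective univalent = mk⇔
  (λ (cycle , R≢O) → point-of-nonempty-cycle cycle R≢O)
  (λ (p , p-point , pR⊆R⁺ , p⊆RᵀL) → CycleFromPoint.nonempty-cycle injective univalent p-point pR⊆R⁺ p⊆RᵀL)
  where open KleeneRelAlgProperties K
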